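{- Let $p$ and $q$ be primes with $p<q$ and let $G$ be a cyclic group of order $pq$. Then \[ \mathcal{B}(G)\cong K_2 \sqcup K_{1, p^2-1} \sqcup K_{1, q^2-1} \sqcup K_{1, p^2q^2-p^2-q^2+1}. \]
   Context: For a finite group $G$, let $L(G)$ be the set of all subgroups of $G$. The subgroup generating bipartite graph (SGB-graph) $\mathcal{B}(G)$ is the bipartite graph with vertex set $(G\times G)\sqcup L(G)$, in which a vertex $(a,b)\in G\times G$ is adjacent to $H\in L(G)$ if and only if $H=\langle a,b\rangle$; there are no other edges. $K_{1,r}$ denotes the star with $r$ leaves, $K_2$ the complete graph on two vertices, and $\sqcup$ the disjoint union of graphs. -}

module Defs where

open import Level using (0ℓ)
open import Data.Nat using (ℕ)
open import Data.Fin using (Fin; zero; suc)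
open import Data.Fin.Properties using (all?)
open import Data.Fin.Subset using (Subset; _∈_; _⊆_; ⊤)
open import Data.Fin.Subset.Properties using (_∈?_)
open import Data.Product using (Σ; _×_; _,_; ∃)
open import Data.Sum using (_⊎_; inj₁; inj₂)
open import Data.Unit using () renaming (⊤ to Unit; tt to unit)
open import Data.Empty using (⊥)
open import Relation.Nullary using (Dec; ¬_)
open import Relation.Nullary.Decidable using (True; _×-dec_; _→-dec_)
open import Relation.Binary.PropositionalEquality using (_≡_)
open import Algebra.Structures using (IsGroup)
open import Function.Bundles using (_↔_; _⇔_; Inverse)

-- Finite groups: a group structure on the carrier Fin n (so |G| = n),
-- with propositional equality.  Every finite group of order n is
-- isomorphic to one of these.

record FinGroup (n : ℕ) : Set where
  field
    _∙_     : Fin n → Fin n → Fin n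
    ε       : Fin n
    _⁻¹     : Fin n → Fin n
    isGroup : IsGroup _≡_ _∙_ ε _⁻¹

module _ {n : ℕ} (G : FinGroup n) where
  open FinGroup G

  IsSubgroup : Subset n → Set
  IsSubgroup S = (ε ∈ S)
               × (∀ x y → x ∈ S → y ∈ S → (x ∙ y) ∈ S)
               × (∀ x → x ∈ S → (x ⁻¹) ∈ S)

  isSubgroup? : (S : Subset n) → Dec (IsSubgroup S)
  isSubgroup? S =
    (ε ∈? S)
    ×-dec all? (λ x → all? (λ y → (x ∈? S) →-dec ((y ∈? S) →-dec ((x ∙ y) ∈? S))))
    ×-dec all? (λ x → (x ∈? S) →-dec ((x ⁻¹) ∈? S))

  -- L(G): the set of subgroups of G (the proof component is irrelevant,
  -- being an element of T b for a boolean b).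
  SubgroupOf : Set
  SubgroupOf = Σ (Subset n) (λ S → True (isSubgroup? S))

  GeneratedBy : (Fin n → Set) → Subset n → Set
  GeneratedBy P H = IsSubgroup H
                  × (∀ x → P x → x ∈ H)
                  × (∀ K → IsSubgroup K → (∀ x → P x → x ∈ K) → H ⊆ K)

  IsCyclic : Set
  IsCyclic = ∃ λ g → GeneratedBy (λ x → x ≡ g) ⊤

  Generates₂ : Fin n → Fin n → Subset n → Set
  Generates₂ a b H = GeneratedBy (λ x → (x ≡ a) ⊎ (x ≡ b)) H

record Graph : Set₁ where
  field
    V   : Set
    Adj : V → V → Set
open Graph public

record _≅_ (Γ Δ : Graph) : Set where
  field
    vmap : V Γ ↔ V Δ
    adj  : ∀ x y → Adj Γ x y ⇔ Adj Δ (Inverse.to vmap x) (Inverse.to vmap y)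

_⊔_ : Graph → Graph → Graph
Γ ⊔ Δ = record { V = V Γ ⊎ V Δ ; Adj = adj }
  where
  adj : V Γ ⊎ V Δ → V Γ ⊎ V Δ → Set
  adj (inj₁ x) (inj₁ y) = Adj Γ x y
  adj (inj₂ x) (inj₂ y) = Adj Δ x y
  adj _ _ = ⊥
infixr 5 _⊔_

K₂ : Graph
K₂ = record { V = Fin 2 ; Adj = λ i j → ¬ (i ≡ j) }

K₁ : ℕ → Graph
K₁ r = record { V = Unit ⊎ Fin r ; Adj = adj }
  where
  adj : Unit ⊎ Fin r → Unit ⊎ Fin r → Set
  adj (inj₁ _) (inj₂ _) = Unit
  adj (inj₂ _) (inj₁ _) = Unit
  adj _ _ = ⊥

SGB : ∀ {n} → FinGroup n → Graph
SGB {n} G = record { V = (Fin n × Fin n) ⊎ SubgroupOf G ; Adj = adj }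
  where
  adj : (Fin n × Fin n) ⊎ SubgroupOf G → (Fin n × Fin n) ⊎ SubgroupOf G → Set
  adj (inj₁ (a , b)) (inj₂ (H , _)) = Generates₂ G a b H
  adj (inj₂ (H , _)) (inj₁ (a , b)) = Generates₂ G a b H
  adj _ _ = ⊥

-- Write G additively through a generator g. By the Chinese remainder theorem
-- (x , y) ↦ (q x + p y) g is an isomorphism ℤ/p × ℤ/q ≅ G, and since q is invertible
-- modulo p, a subgroup containing an element with nonzero p-coordinate contains the whole
-- p-axis (and symmetrically for q). So the subgroups are exactly the four products H (b , c)
-- of an axis or zero in each coordinate, and ⟨a , b⟩ = H (b , c) where b (resp. c) records
-- whether a or b has a nonzero p- (resp. q-) coordinate. Hence B(G) is the bipartite graph
-- of the map (a , b) ↦ ⟨a , b⟩, a disjoint union of four stars centred at the subgroups,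
-- with 1, p² − 1, q² − 1 and (p² − 1)(q² − 1) leaves; the first star is K₂.

module Submission where

open import Defs
open import Level using (0ℓ)
open import Algebra.Bundles using (Group)
open import Data.Bool.Base using (Bool; true; false; f≤t; b≤b) renaming (_≤_ to _≤ᵇ_)
open import Data.Bool.Properties using (≤-maximum; T-irrelevant)
open import Data.Empty using (⊥)
open import Data.Fin.Base using (Fin; zero; suc; toℕ; fromℕ<; punchOut; combine; remQuot)
open import Data.Fin.Properties
  using ( any?; pigeonhole; injective⇒≤; toℕ-injective; toℕ<n; toℕ-fromℕ<; nonZeroIndex; punchOut-injective
        ; *↔×; +↔⊎; 1↔⊤; combine-remQuot; remQuot-combine)
  renaming (_≟_ to _≟ᶠ_)
open import Data.Fin.Subset using (Subset; _∈_; _⊆_; ⊤)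
open import Data.Fin.Subset.Properties using (∈⊤; _∈?_; ⊆-antisym)
open import Data.Nat.Base
  using ( ℕ; zero; suc; _+_; _*_; _∸_; _^_; _≤_; _<_; NonZero; _%_; _/_
        ; s≤s; s≤s⁻¹; >-nonZero; >-nonZero⁻¹; nonTrivial⇒n>1)
open import Data.Nat.Properties
open import Data.Nat.DivMod
open import Data.Nat.Divisibility using (_∣_; ∣m+n∣m⇒∣n; n∣m*n; m∣m*n; ∣m⇒∣m*n; ∣⇒≤; n∣m⇒m%n≡0)
open import Data.Nat.Solver using (module +-*-Solver)
open +-*-Solver using (solve; _:=_; _:+_; _:*_; con)
open import Data.Nat.Primality
  using (Prime; euclidsLemma; prime⇒nonTrivial; prime⇒nonZero; prime⇒irreducible; ¬prime[1])
open import Data.Product.Base as Product using (_×_; _,_; ∃; proj₁; proj₂; zip)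
open import Data.Sum.Base as Sum using (_⊎_; inj₁; inj₂; [_,_]′)
open import Data.Sum.Properties using (inj₁-injective; inj₂-injective)
open import Data.Sum.Algebra using (⊎-cong; ⊎-comm)
open import Data.Product.Algebra using (×-cong)
open import Data.Unit.Base using (tt) renaming (⊤ to Unit)
open import Data.Vec.Base using (tabulate)
open import Data.Vec.Properties using (lookup∘tabulate; []=⇒lookup; lookup⇒[]=)
open import Function.Base using (_∘_; const)
open import Function.Bundles using (_⇔_; mk⇔; Equivalence; _↔_; Inverse; Injection; mk↔ₛ′)
open import Function.Properties.Inverse using (↔-refl; ↔-sym; ↔-trans; ↔⇒↣)
open import Function.Definitions using (Injective)
open import Function.Properties.Equivalence using () renaming (refl to ⇔-refl; trans to ⇔-trans)
open import Relation.Nullary using (Dec; yes; no; ¬_; does; contradiction)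
open import Relation.Nullary.Decidable using (_×-dec_; dec-true; dec-false; decidable-stable; fromWitness; toWitness)
open import Relation.Unary using (Decidable)
open import Relation.Binary.PropositionalEquality

subsetOf : ∀ {n} {P : Fin n → Set} → Decidable P → Subset n
subsetOf P? = tabulate (does ∘ P?)

∈-subsetOf : ∀ {n} {P : Fin n → Set} (P? : Decidable P) {x} → x ∈ subsetOf P? ⇔ P x
∈-subsetOf {P = P} P? {x} = mk⇔ (decided (P? x) ∘ trans (sym (lookup∘tabulate _ x)) ∘ []=⇒lookup)
                               (λ px → lookup⇒[]= x _ (trans (lookup∘tabulate _ x) (accepted (P? x) px)))
  where
  decided : (d : Dec (P x)) → does d ≡ true → P x
  decided (yes px) _ = px
  accepted : (d : Dec (P x)) → P x → does d ≡ true
  accepted (yes _) _ = refl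
  accepted (no ¬px) px = contradiction px ¬px

injective⇒surjective : ∀ {n} {f : Fin n → Fin n} → Injective _≡_ _≡_ f → ∀ y → ∃ λ x → f x ≡ y
injective⇒surjective {suc n} {f} f-inj y with any? (λ x → f x ≟ᶠ y)
... | yes hit = hit
... | no miss = contradiction (injective⇒≤ {f = λ x → punchOut (avoids x)} punchOut-avoids-injective) 1+n≰n
  where
  avoids : ∀ x → y ≢ f x
  avoids x y≡fx = miss (x , sym y≡fx)
  punchOut-avoids-injective : Injective _≡_ _≡_ (λ x → punchOut (avoids x))
  punchOut-avoids-injective = f-inj ∘ punchOut-injective (avoids _) (avoids _)

×-interchange : ∀ {A B C D : Set} → ((A × B) × (C × D)) ↔ ((A × C) × (B × D))
×-interchange = mk↔ₛ′ swap-middle swap-middle (λ _ → refl) (λ _ → refl)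
  where
  swap-middle : ∀ {A B C D : Set} → (A × B) × (C × D) → (A × C) × (B × D)
  swap-middle ((a , b) , (c , d)) = (a , c) , (b , d)

⊎-interchange : ∀ {A B C D : Set} → ((A ⊎ B) ⊎ (C ⊎ D)) ↔ ((A ⊎ C) ⊎ (B ⊎ D))
⊎-interchange = mk↔ₛ′ swap-middle swap-middle swap-middle-involutive swap-middle-involutive
  where
  swap-middle : ∀ {A B C D : Set} → (A ⊎ B) ⊎ (C ⊎ D) → (A ⊎ C) ⊎ (B ⊎ D)
  swap-middle (inj₁ (inj₁ a)) = inj₁ (inj₁ a)
  swap-middle (inj₁ (inj₂ b)) = inj₂ (inj₁ b)
  swap-middle (inj₂ (inj₁ c)) = inj₁ (inj₂ c)
  swap-middle (inj₂ (inj₂ d)) = inj₂ (inj₂ d)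
  swap-middle-involutive : ∀ {A B C D : Set} (u : (A ⊎ B) ⊎ (C ⊎ D)) → swap-middle (swap-middle u) ≡ u
  swap-middle-involutive (inj₁ (inj₁ _)) = refl
  swap-middle-involutive (inj₁ (inj₂ _)) = refl
  swap-middle-involutive (inj₂ (inj₁ _)) = refl
  swap-middle-involutive (inj₂ (inj₂ _)) = refl

-- Arithmetic modulo a prime

∣∧<⇒≡0 : ∀ {d n} → d ∣ n → n < d → n ≡ 0
∣∧<⇒≡0 {n = zero}  _   _   = refl
∣∧<⇒≡0 {n = suc n} d∣n n<d = contradiction (∣⇒≤ d∣n) (<⇒≱ n<d)

0%n≡0 : ∀ n .{{_ : NonZero n}} → 0 % n ≡ 0
0%n≡0 n = m<n⇒m%n≡m (>-nonZero⁻¹ n)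

[m+n]%d≡m%d⇒d∣n : ∀ m n d .{{_ : NonZero d}} → (m + n) % d ≡ m % d → d ∣ n
[m+n]%d≡m%d⇒d∣n m n d eq = ∣m+n∣m⇒∣n (subst (d ∣_) (sym quotients) (n∣m*n ((m + n) / d))) (n∣m*n (m / d))
  where
  open ≡-Reasoning
  quotients : (m / d) * d + n ≡ ((m + n) / d) * d
  quotients = +-cancelˡ-≡ (m % d) _ _ (begin
    m % d + ((m / d) * d + n)        ≡⟨ +-assoc (m % d) _ n ⟨
    (m % d + (m / d) * d) + n        ≡⟨ cong (_+ n) (m≡m%n+[m/n]*n m d) ⟨
    m + n                            ≡⟨ m≡m%n+[m/n]*n (m + n) d ⟩
    (m + n) % d + ((m + n) / d) * d  ≡⟨ cong (_+ ((m + n) / d) * d) eq ⟩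
    m % d + ((m + n) / d) * d        ∎)

toℕ-%-injective : ∀ {m} .{{_ : NonZero m}} {i j : Fin m} → toℕ i % m ≡ toℕ j % m → i ≡ j
toℕ-%-injective {m} {i} {j} eq =
  toℕ-injective (trans (sym (m<n⇒m%n≡m (toℕ<n i))) (trans eq (m<n⇒m%n≡m (toℕ<n j))))

prime>1 : ∀ {p} → Prime p → 1 < p
prime>1 {p} pP = nonTrivial⇒n>1 p {{prime⇒nonTrivial pP}}

prime²≥2 : ∀ {p} → Prime p → 2 ≤ p ^ 2
prime²≥2 {p} pP =
  ≤-trans (prime>1 pP) (subst (p ≤_) (cong (p *_) (sym (*-identityʳ p))) (m≤m*n p p {{prime⇒nonZero pP}}))

prime∤prime : ∀ {p q} → Prime p → Prime q → p ≢ q → ¬ p ∣ q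
prime∤prime pP qP p≢q p∣q with prime⇒irreducible qP p∣q
... | inj₁ refl = contradiction pP ¬prime[1]
... | inj₂ p≡q  = p≢q p≡q

prime∤*-< : ∀ {p u x} → Prime p → ¬ p ∣ u → x ≢ 0 → x < p → ¬ p ∣ u * x
prime∤*-< {u = u} {x} pP p∤u x≢0 x<p p∣ux with euclidsLemma u x pP p∣ux
... | inj₁ p∣u = p∤u p∣u
... | inj₂ p∣x = x≢0 (∣∧<⇒≡0 p∣x x<p)

*-cancelˡ-%-prime : ∀ {p u} x y .{{_ : NonZero p}} → Prime p → ¬ p ∣ u →
                    (u * x) % p ≡ (u * y) % p → x % p ≡ y % p
*-cancelˡ-%-prime {p} {u} x y pP p∤u eq =
  [ (λ x≤y → ordered x≤y (m%n<n y p) (sym eq′)) , (λ y≤x → sym (ordered y≤x (m%n<n x p) eq′)) ]′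
  (≤-total (x % p) (y % p))
  where
  reduce : ∀ z → (u * (z % p)) % p ≡ (u * z) % p
  reduce z = trans (%-distribˡ-* u (z % p) p)
               (trans (cong (λ r → ((u % p) * r) % p) (m%n%n≡m%n z p)) (sym (%-distribˡ-* u z p)))
  eq′ : (u * (x % p)) % p ≡ (u * (y % p)) % p
  eq′ = trans (reduce x) (trans eq (sym (reduce y)))
  ordered : ∀ {x y} → x ≤ y → y < p → (u * y) % p ≡ (u * x) % p → x ≡ y
  ordered {x} {y} x≤y y<p eq = ≤-antisym x≤y (m∸n≡0⇒m≤n (∣∧<⇒≡0 p∣y∸x (≤-<-trans (m∸n≤m y x) y<p)))
    where
    split : u * y ≡ u * x + u * (y ∸ x)
    split = trans (cong (u *_) (sym (m+[n∸m]≡n x≤y))) (*-distribˡ-+ u x (y ∸ x))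
    p∣y∸x : p ∣ y ∸ x
    p∣y∸x with euclidsLemma u (y ∸ x) pP ([m+n]%d≡m%d⇒d∣n (u * x) _ p (subst (λ k → k % p ≡ (u * x) % p) split eq))
    ... | inj₁ p∣u   = contradiction p∣u p∤u
    ... | inj₂ p∣y∸x = p∣y∸x

%-inverse-prime : ∀ {p u} .{{_ : NonZero p}} → Prime p → ¬ p ∣ u → ∃ λ v → (u * v) % p ≡ 1
%-inverse-prime {p} {u} pP p∤u = toℕ v , trans (sym (toℕ-fromℕ< _)) (trans (cong toℕ uv≡1) (toℕ-fromℕ< (prime>1 pP)))
  where
  residue : Fin p → Fin p
  residue x = fromℕ< (m%n<n (u * toℕ x) p)
  residue-injective : Injective _≡_ _≡_ residue
  residue-injective {x} {y} eq = toℕ-%-injective (*-cancelˡ-%-prime (toℕ x) (toℕ y) pP p∤u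
    (trans (sym (toℕ-fromℕ< _)) (trans (cong toℕ eq) (toℕ-fromℕ< _))))
  v : Fin p
  v = proj₁ (injective⇒surjective residue-injective (fromℕ< (prime>1 pP)))
  uv≡1 : residue v ≡ fromℕ< (prime>1 pP)
  uv≡1 = proj₂ (injective⇒surjective residue-injective (fromℕ< (prime>1 pP)))

[m∸1]*[n∸1]≡m*n∸m∸n+1 : ∀ {m n} → 2 ≤ m → 2 ≤ n → (m ∸ 1) * (n ∸ 1) ≡ m * n ∸ m ∸ n + 1
[m∸1]*[n∸1]≡m*n∸m∸n+1 {m@(suc (suc a))} {n@(suc (suc b))} (s≤s (s≤s _)) (s≤s (s≤s _)) = sym (begin
  m * n ∸ m ∸ n + 1              ≡⟨ cong (λ k → k ∸ m ∸ n + 1) expand ⟩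
  m + (n + c) ∸ m ∸ n + 1        ≡⟨ cong (λ k → k ∸ n + 1) (m+n∸m≡n m (n + c)) ⟩
  n + c ∸ n + 1                  ≡⟨ cong (_+ 1) (m+n∸m≡n n c) ⟩
  c + 1                          ≡⟨ solve 2 (λ a b → a :* b :+ a :+ b :+ con 1 := (con 1 :+ a) :* (con 1 :+ b)) refl a b ⟩
  suc a * suc b                  ∎)
  where
  open ≡-Reasoning
  c = a * b + a + b
  expand : m * n ≡ m + (n + c)
  expand = solve 2 (λ a b → (con 2 :+ a) :* (con 2 :+ b) := (con 2 :+ a) :+ ((con 2 :+ b) :+ (a :* b :+ a :+ b))) refl a b

-- Powers in finite groups

module FinGroupProperties {n : ℕ} (G : FinGroup n) where
  open FinGroup G public

  group : Group 0ℓ 0ℓ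
  group = record { Carrier = Fin n ; _≈_ = _≡_ ; _∙_ = _∙_ ; ε = ε ; _⁻¹ = _⁻¹ ; isGroup = isGroup }

  open Group group public using (monoid; assoc; identityˡ; identityʳ)
  open import Algebra.Properties.Group group public using (inverseʳ-unique; ∙-cancelˡ)
  -- k ×ᴳ z is the k-th power z ∙ (z ∙ ⋯ (z ∙ ε)) of z.
  open import Algebra.Properties.Monoid.Mult monoid public
    using (×-homo-+; ×-assocˡ; ×-homo-1) renaming (_×_ to _×ᴳ_)

  ×ᴳ-ε : ∀ k → k ×ᴳ ε ≡ ε
  ×ᴳ-ε zero    = refl
  ×ᴳ-ε (suc k) = trans (identityˡ _) (×ᴳ-ε k)

  ×ᴳ-cancel : ∀ z i d → (i + d) ×ᴳ z ≡ i ×ᴳ z → d ×ᴳ z ≡ ε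
  ×ᴳ-cancel z i d eq = ∙-cancelˡ (i ×ᴳ z) _ _ (trans (sym (×-homo-+ z i d)) (trans eq (sym (identityʳ _))))

  ×ᴳ-periodic : ∀ z d → d ×ᴳ z ≡ ε → ∀ k m → (m + k * d) ×ᴳ z ≡ m ×ᴳ z
  ×ᴳ-periodic z d dz≡ε k m = begin
    (m + k * d) ×ᴳ z             ≡⟨ ×-homo-+ z m (k * d) ⟩
    (m ×ᴳ z) ∙ ((k * d) ×ᴳ z)    ≡⟨ cong ((m ×ᴳ z) ∙_) (×-assocˡ z k d) ⟨
    (m ×ᴳ z) ∙ (k ×ᴳ (d ×ᴳ z))   ≡⟨ cong (λ w → (m ×ᴳ z) ∙ (k ×ᴳ w)) dz≡ε ⟩
    (m ×ᴳ z) ∙ (k ×ᴳ ε)          ≡⟨ cong ((m ×ᴳ z) ∙_) (×ᴳ-ε k) ⟩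
    (m ×ᴳ z) ∙ ε                 ≡⟨ identityʳ _ ⟩
    m ×ᴳ z                       ∎
    where open ≡-Reasoning

  ×ᴳ-% : ∀ z d .{{_ : NonZero d}} → d ×ᴳ z ≡ ε → ∀ k → k ×ᴳ z ≡ (k % d) ×ᴳ z
  ×ᴳ-% z d dz≡ε k = trans (cong (_×ᴳ z) (m≡m%n+[m/n]*n k d)) (×ᴳ-periodic z d dz≡ε (k / d) (k % d))

  ×ᴳ-torsion : ∀ z d → d ×ᴳ z ≡ ε → ∀ k → d ×ᴳ (k ×ᴳ z) ≡ ε
  ×ᴳ-torsion z d dz≡ε k = begin
    d ×ᴳ (k ×ᴳ z)     ≡⟨ ×-assocˡ z d k ⟩
    (d * k) ×ᴳ z      ≡⟨ cong (_×ᴳ z) (*-comm d k) ⟩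
    (0 + k * d) ×ᴳ z  ≡⟨ ×ᴳ-periodic z d dz≡ε k 0 ⟩
    ε                 ∎
    where open ≡-Reasoning

  ⁻¹≡[d∸1]×ᴳ : ∀ z d .{{_ : NonZero d}} → d ×ᴳ z ≡ ε → z ⁻¹ ≡ (d ∸ 1) ×ᴳ z
  ⁻¹≡[d∸1]×ᴳ z (suc d) dz≡ε = sym (inverseʳ-unique z (d ×ᴳ z) dz≡ε)

  ×ᴳ-∈ : ∀ {K} → ε ∈ K → (∀ x y → x ∈ K → y ∈ K → (x ∙ y) ∈ K) → ∀ k {z} → z ∈ K → k ×ᴳ z ∈ K
  ×ᴳ-∈ ε∈K ∙-closed zero    z∈K = ε∈K
  ×ᴳ-∈ ε∈K ∙-closed (suc k) z∈K = ∙-closed _ _ z∈K (×ᴳ-∈ ε∈K ∙-closed k z∈K)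

  ∙-closed⇒subgroup : ∀ {K} d .{{_ : NonZero d}} → (∀ {z} → z ∈ K → d ×ᴳ z ≡ ε) →
                      ε ∈ K → (∀ x y → x ∈ K → y ∈ K → (x ∙ y) ∈ K) → IsSubgroup G K
  ∙-closed⇒subgroup {K} d torsion ε∈K ∙-closed = ε∈K , ∙-closed , inverse-closed
    where
    inverse-closed : ∀ z → z ∈ K → (z ⁻¹) ∈ K
    inverse-closed z z∈K =
      subst (_∈ K) (sym (⁻¹≡[d∸1]×ᴳ z d (torsion z∈K))) (×ᴳ-∈ ε∈K ∙-closed (d ∸ 1) z∈K)

-- Cyclic groups

module Cyclic {N : ℕ} (G : FinGroup N) {g : Fin N} (gen : GeneratedBy G (_≡ g) ⊤) where
  open FinGroupProperties G

  instance
    N≢0 : NonZero N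
    N≢0 = nonZeroIndex ε

  isPowerBelow? : ∀ d z → Dec (∃ λ (k : Fin d) → toℕ k ×ᴳ g ≡ z)
  isPowerBelow? d z = any? (λ k → (toℕ k ×ᴳ g) ≟ᶠ z)

  powersBelow : ℕ → Subset N
  powersBelow d = subsetOf (isPowerBelow? d)

  module _ (d : ℕ) .{{_ : NonZero d}} (dg≡ε : d ×ᴳ g ≡ ε) where
    ×ᴳg∈powersBelow : ∀ k → k ×ᴳ g ∈ powersBelow d
    ×ᴳg∈powersBelow k = Equivalence.from (∈-subsetOf (isPowerBelow? d))
      (fromℕ< (m%n<n k d) , trans (cong (_×ᴳ g) (toℕ-fromℕ< (m%n<n k d))) (sym (×ᴳ-% g d dg≡ε k)))

    powersBelow-exponent : ∀ {z} → z ∈ powersBelow d → ∃ λ (k : Fin d) → toℕ k ×ᴳ g ≡ z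
    powersBelow-exponent = Equivalence.to (∈-subsetOf (isPowerBelow? d))

    powersBelow-subgroup : IsSubgroup G (powersBelow d)
    powersBelow-subgroup = ∙-closed⇒subgroup d torsion (×ᴳg∈powersBelow 0) ∙-closed
      where
      torsion : ∀ {z} → z ∈ powersBelow d → d ×ᴳ z ≡ ε
      torsion z∈ with powersBelow-exponent z∈
      ... | k , refl = ×ᴳ-torsion g d dg≡ε (toℕ k)
      ∙-closed : ∀ x y → x ∈ powersBelow d → y ∈ powersBelow d → (x ∙ y) ∈ powersBelow d
      ∙-closed x y x∈ y∈ with powersBelow-exponent x∈ | powersBelow-exponent y∈
      ... | i , refl | j , refl =
        subst (_∈ powersBelow d) (×-homo-+ g (toℕ i) (toℕ j)) (×ᴳg∈powersBelow (toℕ i + toℕ j))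

    powersBelow-all : ∀ z → z ∈ powersBelow d
    powersBelow-all z = proj₂ (proj₂ gen) (powersBelow d) powersBelow-subgroup g∈ ∈⊤
      where
      g∈ : ∀ x → x ≡ g → x ∈ powersBelow d
      g∈ x refl = subst (_∈ powersBelow d) (×-homo-1 g) (×ᴳg∈powersBelow 1)

    period-≥ : N ≤ d
    period-≥ = injective⇒≤ {f = exponent} exponent-injective
      where
      exponent : Fin N → Fin d
      exponent z = proj₁ (powersBelow-exponent (powersBelow-all z))
      exponent-injective : Injective _≡_ _≡_ exponent
      exponent-injective {x} {y} eq = trans (sym (proj₂ (powersBelow-exponent (powersBelow-all x))))
        (trans (cong (λ k → toℕ k ×ᴳ g) eq) (proj₂ (powersBelow-exponent (powersBelow-all y))))

  -- Pigeonhole gives a period of g that is at most N, and period-≥ bounds it below by N.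
  N×ᴳg≡ε : N ×ᴳ g ≡ ε
  N×ᴳg≡ε with pigeonhole (n<1+n N) (λ (i : Fin (suc N)) → toℕ i ×ᴳ g)
  ... | i , j , i<j , gⁱ≡gʲ = subst (λ d → d ×ᴳ g ≡ ε) (≤-antisym d≤N (period-≥ d {{d≢0}} dg≡ε)) dg≡ε
    where
    d = toℕ j ∸ toℕ i
    d≢0 : NonZero d
    d≢0 = >-nonZero (m<n⇒0<n∸m i<j)
    d≤N : d ≤ N
    d≤N = ≤-trans (m∸n≤m (toℕ j) (toℕ i)) (s≤s⁻¹ (toℕ<n j))
    dg≡ε : d ×ᴳ g ≡ ε
    dg≡ε = ×ᴳ-cancel g (toℕ i) d (trans (cong (_×ᴳ g) (m+[n∸m]≡n (<⇒≤ i<j))) (sym gⁱ≡gʲ))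

  ×ᴳg-injective : ∀ {i j} → i < N → j < N → i ×ᴳ g ≡ j ×ᴳ g → i ≡ j
  ×ᴳg-injective {i} {j} i<N j<N gⁱ≡gʲ =
    [ (λ i≤j → ordered i≤j j<N gⁱ≡gʲ) , (λ j≤i → sym (ordered j≤i i<N (sym gⁱ≡gʲ))) ]′ (≤-total i j)
    where
    ordered : ∀ {i j} → i ≤ j → j < N → i ×ᴳ g ≡ j ×ᴳ g → i ≡ j
    ordered {i} {j} i≤j j<N gⁱ≡gʲ with j ∸ i in j∸i≡d
    ... | zero  = ≤-antisym i≤j (m∸n≡0⇒m≤n j∸i≡d)
    ... | suc d = contradiction (period-≥ (suc d) dg≡ε) (<⇒≱ (≤-<-trans (subst (_≤ j) j∸i≡d (m∸n≤m j i)) j<N))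
      where
      dg≡ε : suc d ×ᴳ g ≡ ε
      dg≡ε = ×ᴳ-cancel g i (suc d) (trans (cong (λ e → (i + e) ×ᴳ g) (sym j∸i≡d))
               (trans (cong (_×ᴳ g) (m+[n∸m]≡n i≤j)) (sym gⁱ≡gʲ)))

  ×ᴳg-≡⇒%≡ : ∀ {i j} → i ×ᴳ g ≡ j ×ᴳ g → i % N ≡ j % N
  ×ᴳg-≡⇒%≡ {i} {j} gⁱ≡gʲ = ×ᴳg-injective (m%n<n i N) (m%n<n j N)
    (trans (sym (×ᴳ-% g N N×ᴳg≡ε i)) (trans gⁱ≡gʲ (×ᴳ-% g N N×ᴳg≡ε j)))

  ×ᴳg-surjective : ∀ z → ∃ λ k → k ×ᴳ g ≡ z
  ×ᴳg-surjective z = toℕ (proj₁ exponent) , proj₂ exponent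
    where
    exponent : ∃ λ (k : Fin N) → toℕ k ×ᴳ g ≡ z
    exponent = powersBelow-exponent N N×ᴳg≡ε (powersBelow-all N N×ᴳg≡ε z)

  N×ᴳz≡ε : ∀ z → N ×ᴳ z ≡ ε
  N×ᴳz≡ε z = subst (λ w → N ×ᴳ w ≡ ε) (proj₂ (×ᴳg-surjective z))
               (×ᴳ-torsion g N N×ᴳg≡ε (proj₁ (×ᴳg-surjective z)))

Within : ∀ {m} → Bool → Fin m → Set
Within true  _ = Unit
Within false x = toℕ x ≡ 0

Within? : ∀ {m} b (x : Fin m) → Dec (Within b x)
Within? true  _ = yes tt
Within? false x = toℕ x ≟ 0

Within-mono : ∀ {m b b′} {x : Fin m} → b ≤ᵇ b′ → Within b x → Within b′ x
Within-mono f≤t _ = tt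
Within-mono b≤b w = w

Within-zero : ∀ {m} b {x : Fin m} → toℕ x ≡ 0 → Within b x
Within-zero true  _   = tt
Within-zero false x≡0 = x≡0

Within-+ : ∀ {m} .{{_ : NonZero m}} b {x y z : Fin m} → toℕ z ≡ (toℕ x + toℕ y) % m →
           Within b x → Within b y → Within b z
Within-+ true  _ _ _ = tt
Within-+ {m} false z≡x+y x≡0 y≡0 = trans z≡x+y (trans (cong₂ (λ a b → (a + b) % m) x≡0 y≡0) (0%n≡0 m))

isInj₂ : ∀ {A B : Set} → A ⊎ B → Bool
isInj₂ = [ const false , const true ]′

-- (zero , zero) is sent to inj₁ tt by computation, so anyNonzero tests whether a pair of
-- residues is nonzero.
pairSplit : ∀ m .{{_ : NonZero m}} → (Fin m × Fin m) ↔ (Unit ⊎ Fin (m * m ∸ 1))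
pairSplit (suc m) = ↔-trans (↔-sym *↔×) (↔-trans +↔⊎ (⊎-cong 1↔⊤ ↔-refl))

anyNonzero : ∀ {m} .{{_ : NonZero m}} → Fin m × Fin m → Bool
anyNonzero {m} = isInj₂ ∘ Inverse.to (pairSplit m)

anyNonzero≡false⇔ : ∀ {m} .{{_ : NonZero m}} {x y : Fin m} →
                    anyNonzero (x , y) ≡ false ⇔ (toℕ x ≡ 0 × toℕ y ≡ 0)
anyNonzero≡false⇔ {suc m} {x} {y} = mk⇔ zeroes nonzero
  where
  open Inverse (pairSplit (suc m))
  zeroes : anyNonzero (x , y) ≡ false → toℕ x ≡ 0 × toℕ y ≡ 0
  zeroes eq with to (x , y) | strictlyInverseʳ (x , y)
  ... | inj₁ tt | refl = refl , refl
  nonzero : toℕ x ≡ 0 × toℕ y ≡ 0 → anyNonzero (x , y) ≡ false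
  nonzero (x≡0 , y≡0) with toℕ-injective {i = x} {j = zero} x≡0 | toℕ-injective {i = y} {j = zero} y≡0
  ... | refl | refl = refl

within-anyNonzero : ∀ {m} .{{_ : NonZero m}} (x y : Fin m) →
                    Within (anyNonzero (x , y)) x × Within (anyNonzero (x , y)) y
within-anyNonzero x y with anyNonzero (x , y) in eq
... | true  = tt , tt
... | false = Equivalence.to anyNonzero≡false⇔ eq

anyNonzero-least : ∀ {m} .{{_ : NonZero m}} {b} {x y : Fin m} → Within b x → Within b y → anyNonzero (x , y) ≤ᵇ b
anyNonzero-least {b = true}  _   _   = ≤-maximum _
anyNonzero-least {b = false} x≡0 y≡0 =
  subst (_≤ᵇ false) (sym (Equivalence.from anyNonzero≡false⇔ (x≡0 , y≡0))) b≤b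

-- Bipartite graphs of functions

functionGraph : ∀ {X Y : Set} → (X → Y) → Graph
functionGraph {X} {Y} f = record { V = X ⊎ Y ; Adj = edge }
  where
  edge : X ⊎ Y → X ⊎ Y → Set
  edge (inj₁ x) (inj₂ y) = f x ≡ y
  edge (inj₂ y) (inj₁ x) = f x ≡ y
  edge _        _        = ⊥

AdjacencyPreserving : (Γ Δ : Graph) → (V Γ → V Δ) → Set
AdjacencyPreserving Γ Δ f = ∀ x y → Adj Γ x y ⇔ Adj Δ (f x) (f y)

open _≅_ using (vmap; adj)

≅-refl : ∀ {Γ} → Γ ≅ Γ
≅-refl = record { vmap = ↔-refl ; adj = λ _ _ → ⇔-refl }

≅-trans : ∀ {Γ Δ Θ} → Γ ≅ Δ → Δ ≅ Θ → Γ ≅ Θ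
≅-trans φ ψ = record
  { vmap = ↔-trans (vmap φ) (vmap ψ)
  ; adj  = λ x y → ⇔-trans (adj φ x y) (adj ψ _ _)
  }

⊔-cong : ∀ {Γ Γ′ Δ Δ′} → Γ ≅ Γ′ → Δ ≅ Δ′ → (Γ ⊔ Δ) ≅ (Γ′ ⊔ Δ′)
⊔-cong {Γ} {Γ′} {Δ} {Δ′} φ ψ = record { vmap = ⊎-cong (vmap φ) (vmap ψ) ; adj = edges }
  where
  edges : AdjacencyPreserving (Γ ⊔ Δ) (Γ′ ⊔ Δ′) (Inverse.to (⊎-cong (vmap φ) (vmap ψ)))
  edges (inj₁ x) (inj₁ y) = adj φ x y
  edges (inj₂ x) (inj₂ y) = adj ψ x y
  edges (inj₁ _) (inj₂ _) = ⇔-refl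
  edges (inj₂ _) (inj₁ _) = ⇔-refl

K₁-cong : ∀ {r s} → r ≡ s → K₁ r ≅ K₁ s
K₁-cong refl = ≅-refl

K₁1≅K₂ : K₁ 1 ≅ K₂
K₁1≅K₂ = record
  { vmap = mk↔ₛ′ to from (λ { zero → refl ; (suc zero) → refl }) (λ { (inj₁ tt) → refl ; (inj₂ zero) → refl })
  ; adj  = edges
  }
  where
  to : Unit ⊎ Fin 1 → Fin 2
  to (inj₁ tt)   = zero
  to (inj₂ zero) = suc zero
  from : Fin 2 → Unit ⊎ Fin 1
  from zero       = inj₁ tt
  from (suc zero) = inj₂ zero
  edges : AdjacencyPreserving (K₁ 1) K₂ to
  edges (inj₁ tt)   (inj₁ tt)   = mk⇔ (λ ()) (λ u≢u → u≢u refl)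
  edges (inj₁ tt)   (inj₂ zero) = mk⇔ (λ _ ()) (λ _ → tt)
  edges (inj₂ zero) (inj₁ tt)   = mk⇔ (λ _ ()) (λ _ → tt)
  edges (inj₂ zero) (inj₂ zero) = mk⇔ (λ ()) (λ u≢u → u≢u refl)

functionGraph-cong : ∀ {X X′ Y Y′ : Set} {f : X → Y} {f′ : X′ → Y′} (φ : X ↔ X′) (ψ : Y ↔ Y′) →
                     (∀ x → f′ (Inverse.to φ x) ≡ Inverse.to ψ (f x)) → functionGraph f ≅ functionGraph f′
functionGraph-cong {f = f} {f′} φ ψ commutes = record { vmap = ⊎-cong φ ψ ; adj = edges }
  where
  arrow : ∀ x y → f x ≡ y ⇔ f′ (Inverse.to φ x) ≡ Inverse.to ψ y
  arrow x y = mk⇔ (λ fx≡y → trans (commutes x) (cong (Inverse.to ψ) fx≡y))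
                  (λ eq → Injection.injective (↔⇒↣ ψ) (trans (sym (commutes x)) eq))
  edges : AdjacencyPreserving (functionGraph f) (functionGraph f′) (Inverse.to (⊎-cong φ ψ))
  edges (inj₁ x) (inj₂ y) = arrow x y
  edges (inj₂ y) (inj₁ x) = arrow x y
  edges (inj₁ _) (inj₁ _) = ⇔-refl
  edges (inj₂ _) (inj₂ _) = ⇔-refl

functionGraph-⊎ : ∀ {X X′ Y Y′ : Set} {f : X → Y} {g : X′ → Y′} →
                  functionGraph (Sum.map f g) ≅ (functionGraph f ⊔ functionGraph g)
functionGraph-⊎ {f = f} {g} = record { vmap = ⊎-interchange ; adj = edges }
  where
  edges : AdjacencyPreserving (functionGraph (Sum.map f g)) (functionGraph f ⊔ functionGraph g) (Inverse.to ⊎-interchange)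
  edges (inj₁ (inj₁ x)) (inj₂ (inj₁ y)) = mk⇔ inj₁-injective (cong inj₁)
  edges (inj₂ (inj₁ y)) (inj₁ (inj₁ x)) = mk⇔ inj₁-injective (cong inj₁)
  edges (inj₁ (inj₂ x)) (inj₂ (inj₂ y)) = mk⇔ inj₂-injective (cong inj₂)
  edges (inj₂ (inj₂ y)) (inj₁ (inj₂ x)) = mk⇔ inj₂-injective (cong inj₂)
  edges (inj₁ (inj₁ _)) (inj₂ (inj₂ _)) = mk⇔ (λ ()) λ ()
  edges (inj₂ (inj₂ _)) (inj₁ (inj₁ _)) = mk⇔ (λ ()) λ ()
  edges (inj₁ (inj₂ _)) (inj₂ (inj₁ _)) = mk⇔ (λ ()) λ ()
  edges (inj₂ (inj₁ _)) (inj₁ (inj₂ _)) = mk⇔ (λ ()) λ ()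
  edges (inj₁ (inj₁ _)) (inj₁ (inj₁ _)) = ⇔-refl
  edges (inj₁ (inj₁ _)) (inj₁ (inj₂ _)) = ⇔-refl
  edges (inj₁ (inj₂ _)) (inj₁ (inj₁ _)) = ⇔-refl
  edges (inj₁ (inj₂ _)) (inj₁ (inj₂ _)) = ⇔-refl
  edges (inj₂ (inj₁ _)) (inj₂ (inj₁ _)) = ⇔-refl
  edges (inj₂ (inj₁ _)) (inj₂ (inj₂ _)) = ⇔-refl
  edges (inj₂ (inj₂ _)) (inj₂ (inj₁ _)) = ⇔-refl
  edges (inj₂ (inj₂ _)) (inj₂ (inj₂ _)) = ⇔-refl

functionGraph-const≅K₁ : ∀ r → functionGraph (λ (_ : Fin r) → tt) ≅ K₁ r
functionGraph-const≅K₁ r = record { vmap = ⊎-comm (Fin r) Unit ; adj = edges }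
  where
  edges : AdjacencyPreserving (functionGraph (λ (_ : Fin r) → tt)) (K₁ r) (Inverse.to (⊎-comm (Fin r) Unit))
  edges (inj₁ _) (inj₂ _) = mk⇔ (λ _ → tt) (λ _ → refl)
  edges (inj₂ _) (inj₁ _) = mk⇔ (λ _ → tt) (λ _ → refl)
  edges (inj₁ _) (inj₁ _) = ⇔-refl
  edges (inj₂ _) (inj₂ _) = ⇔-refl

support : ∀ {A B : Set} → (Unit ⊎ A) × (Unit ⊎ B) → Bool × Bool
support = Product.map isInj₂ isInj₂

functionGraph-support≅stars : ∀ A B →
                              functionGraph (support {Fin A} {Fin B}) ≅ (K₁ 1 ⊔ K₁ A ⊔ K₁ B ⊔ K₁ (A * B))
functionGraph-support≅stars A B = ≅-trans (functionGraph-cong cells corners commutes) stars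
  where
  cell : ∀ {X : Set} → X → Unit
  cell _ = tt
  cells : ((Unit ⊎ Fin A) × (Unit ⊎ Fin B)) ↔ (Fin 1 ⊎ Fin A ⊎ Fin B ⊎ Fin (A * B))
  cells = mk↔ₛ′ to from to∘from from∘to
    where
    to : (Unit ⊎ Fin A) × (Unit ⊎ Fin B) → Fin 1 ⊎ Fin A ⊎ Fin B ⊎ Fin (A * B)
    to (inj₁ _ , inj₁ _) = inj₁ zero
    to (inj₂ i , inj₁ _) = inj₂ (inj₁ i)
    to (inj₁ _ , inj₂ j) = inj₂ (inj₂ (inj₁ j))
    to (inj₂ i , inj₂ j) = inj₂ (inj₂ (inj₂ (combine i j)))
    from : Fin 1 ⊎ Fin A ⊎ Fin B ⊎ Fin (A * B) → (Unit ⊎ Fin A) × (Unit ⊎ Fin B)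
    from (inj₁ _)               = inj₁ tt , inj₁ tt
    from (inj₂ (inj₁ i))        = inj₂ i , inj₁ tt
    from (inj₂ (inj₂ (inj₁ j))) = inj₁ tt , inj₂ j
    from (inj₂ (inj₂ (inj₂ k))) = Product.map inj₂ inj₂ (remQuot B k)
    to∘from : ∀ c → to (from c) ≡ c
    to∘from (inj₁ zero)            = refl
    to∘from (inj₂ (inj₁ _))        = refl
    to∘from (inj₂ (inj₂ (inj₁ _))) = refl
    to∘from (inj₂ (inj₂ (inj₂ k))) = cong (inj₂ ∘ inj₂ ∘ inj₂) (combine-remQuot {A} B k)
    from∘to : ∀ u → from (to u) ≡ u
    from∘to (inj₁ tt , inj₁ tt) = refl
    from∘to (inj₂ _  , inj₁ tt) = refl
    from∘to (inj₁ tt , inj₂ _)  = refl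
    from∘to (inj₂ i  , inj₂ j)  = cong (Product.map inj₂ inj₂) (remQuot-combine i j)
  corners : (Bool × Bool) ↔ (Unit ⊎ Unit ⊎ Unit ⊎ Unit)
  corners = mk↔ₛ′ to from to∘from from∘to
    where
    to : Bool × Bool → Unit ⊎ Unit ⊎ Unit ⊎ Unit
    to (false , false) = inj₁ tt
    to (true  , false) = inj₂ (inj₁ tt)
    to (false , true)  = inj₂ (inj₂ (inj₁ tt))
    to (true  , true)  = inj₂ (inj₂ (inj₂ tt))
    from : Unit ⊎ Unit ⊎ Unit ⊎ Unit → Bool × Bool
    from (inj₁ _)               = false , false
    from (inj₂ (inj₁ _))        = true  , false
    from (inj₂ (inj₂ (inj₁ _))) = false , true
    from (inj₂ (inj₂ (inj₂ _))) = true  , true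
    to∘from : ∀ c → to (from c) ≡ c
    to∘from (inj₁ _)               = refl
    to∘from (inj₂ (inj₁ _))        = refl
    to∘from (inj₂ (inj₂ (inj₁ _))) = refl
    to∘from (inj₂ (inj₂ (inj₂ _))) = refl
    from∘to : ∀ bc → from (to bc) ≡ bc
    from∘to (false , false) = refl
    from∘to (true  , false) = refl
    from∘to (false , true)  = refl
    from∘to (true  , true)  = refl
  commutes : ∀ u → Sum.map cell (Sum.map cell (Sum.map cell cell)) (Inverse.to cells u) ≡ Inverse.to corners (support u)
  commutes (inj₁ _ , inj₁ _) = refl
  commutes (inj₂ _ , inj₁ _) = refl
  commutes (inj₁ _ , inj₂ _) = refl
  commutes (inj₂ _ , inj₂ _) = refl
  stars : functionGraph (Sum.map cell (Sum.map cell (Sum.map cell cell))) ≅ (K₁ 1 ⊔ K₁ A ⊔ K₁ B ⊔ K₁ (A * B))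
  stars = ≅-trans functionGraph-⊎ (⊔-cong (functionGraph-const≅K₁ 1)
          (≅-trans functionGraph-⊎ (⊔-cong (functionGraph-const≅K₁ A)
          (≅-trans functionGraph-⊎ (⊔-cong (functionGraph-const≅K₁ B) (functionGraph-const≅K₁ (A * B)))))))

module _ {n : ℕ} (G : FinGroup n) where

  SubgroupOf-≡ : ∀ {S S′ : Subset n} {s s′} → S ≡ S′ → _≡_ {A = SubgroupOf G} (S , s) (S′ , s′)
  SubgroupOf-≡ refl = cong (_ ,_) (T-irrelevant _ _)

  Generates₂-unique : ∀ {a b H H′} → Generates₂ G a b H → Generates₂ G a b H′ → H ≡ H′
  Generates₂-unique (H-subgroup , a,b∈H , H-least) (H′-subgroup , a,b∈H′ , H′-least) =
    ⊆-antisym (H-least _ H′-subgroup a,b∈H′) (H′-least _ H-subgroup a,b∈H)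

  SGB≅functionGraph : (span : Fin n × Fin n → SubgroupOf G) →
                      (∀ a b → Generates₂ G a b (proj₁ (span (a , b)))) → SGB G ≅ functionGraph span
  SGB≅functionGraph span spans = record { vmap = ↔-refl ; adj = edges }
    where
    generated : ∀ a b K → Generates₂ G a b (proj₁ K) ⇔ span (a , b) ≡ K
    generated a b K = mk⇔ (λ a,b⇒K → SubgroupOf-≡ (Generates₂-unique (spans a b) a,b⇒K))
                          (λ { refl → spans a b })
    edges : AdjacencyPreserving (SGB G) (functionGraph span) (λ u → u)
    edges (inj₁ (a , b)) (inj₂ K) = generated a b K
    edges (inj₂ K) (inj₁ (a , b)) = generated a b K
    edges (inj₁ _) (inj₁ _) = ⇔-refl
    edges (inj₂ _) (inj₂ _) = ⇔-refl

-- The cyclic group of order pq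

module CyclicOfOrderPQ {p q : ℕ} (pP : Prime p) (qP : Prime q) (p≢q : p ≢ q)
                       (G : FinGroup (p * q)) {g : Fin (p * q)} (gen : GeneratedBy G (_≡ g) ⊤) where
  open FinGroupProperties G
  open Cyclic G gen

  instance
    p≢0 : NonZero p
    p≢0 = prime⇒nonZero pP
    q≢0 : NonZero q
    q≢0 = prime⇒nonZero qP

  p∤q : ¬ p ∣ q
  p∤q = prime∤prime pP qP p≢q

  q∤p : ¬ q ∣ p
  q∤p = prime∤prime qP pP (p≢q ∘ sym)

  -- E is kept opaque: unification problems E x y = E x′ y′ would otherwise unfold the
  -- power and become prohibitively expensive.
  opaque
    E : ℕ → ℕ → Fin (p * q)
    E x y = (q * x + p * y) ×ᴳ g

    E-+ : ∀ x y x′ y′ → E (x + x′) (y + y′) ≡ E x y ∙ E x′ y′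
    E-+ x y x′ y′ = trans (cong (_×ᴳ g) (solve 6 (λ p q x y x′ y′ →
        q :* (x :+ x′) :+ p :* (y :+ y′) := (q :* x :+ p :* y) :+ (q :* x′ :+ p :* y′)) refl p q x y x′ y′))
      (×-homo-+ g (q * x + p * y) (q * x′ + p * y′))

    ×ᴳ-E : ∀ k x y → k ×ᴳ E x y ≡ E (k * x) (k * y)
    ×ᴳ-E k x y = trans (×-assocˡ g k _) (cong (_×ᴳ g) (solve 5 (λ p q k x y →
        k :* (q :* x :+ p :* y) := q :* (k :* x) :+ p :* (k :* y)) refl p q k x y))

    E-% : ∀ x y → E x y ≡ E (x % p) (y % q)
    E-% x y = trans (cong (_×ᴳ g) exponent) (×ᴳ-periodic g (p * q) N×ᴳg≡ε (x / p + y / q) (q * (x % p) + p * (y % q)))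
      where
      exponent : q * x + p * y ≡ (q * (x % p) + p * (y % q)) + (x / p + y / q) * (p * q)
      exponent = trans (cong₂ (λ x y → q * x + p * y) (m≡m%n+[m/n]*n x p) (m≡m%n+[m/n]*n y q))
        (solve 6 (λ p q r₁ d₁ r₂ d₂ → q :* (r₁ :+ d₁ :* p) :+ p :* (r₂ :+ d₂ :* q)
                   := (q :* r₁ :+ p :* r₂) :+ (d₁ :+ d₂) :* (p :* q)) refl p q (x % p) (x / p) (y % q) (y / q))

    E-≡⇒%≡ : ∀ {x y x′ y′} → E x y ≡ E x′ y′ → x % p ≡ x′ % p × y % q ≡ y′ % q
    E-≡⇒%≡ {x} {y} {x′} {y′} eq =
      *-cancelˡ-%-prime x x′ pP p∤q p-residues , *-cancelˡ-%-prime y y′ qP q∤p q-residues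
      where
      open ≡-Reasoning
      modulo : ∀ d .{{_ : NonZero d}} → d ∣ p * q → (q * x + p * y) % d ≡ (q * x′ + p * y′) % d
      modulo d d∣pq = trans (sym (m∣n⇒o%n%m≡o%m d (p * q) _ d∣pq))
        (trans (cong (_% d) (×ᴳg-≡⇒%≡ eq)) (m∣n⇒o%n%m≡o%m d (p * q) _ d∣pq))
      p-residues : (q * x) % p ≡ (q * x′) % p
      p-residues = begin
        (q * x) % p             ≡⟨ %-remove-+ʳ (q * x) (m∣m*n y) ⟨
        (q * x + p * y) % p     ≡⟨ modulo p (m∣m*n q) ⟩
        (q * x′ + p * y′) % p   ≡⟨ %-remove-+ʳ (q * x′) (m∣m*n y′) ⟩
        (q * x′) % p            ∎
      q-residues : (p * y) % q ≡ (p * y′) % q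
      q-residues = begin
        (p * y) % q             ≡⟨ %-remove-+ˡ (p * y) (m∣m*n x) ⟨
        (q * x + p * y) % q     ≡⟨ modulo q (n∣m*n p) ⟩
        (q * x′ + p * y′) % q   ≡⟨ %-remove-+ˡ (p * y′) (m∣m*n x′) ⟩
        (p * y′) % q            ∎

    E00≡ε : E 0 0 ≡ ε
    E00≡ε = cong (_×ᴳ g) (cong₂ _+_ (*-zeroʳ q) (*-zeroʳ p))

  E-%-cong : ∀ {x y x′ y′} → x % p ≡ x′ % p → y % q ≡ y′ % q → E x y ≡ E x′ y′
  E-%-cong {x} {y} {x′} {y′} x≡x′ y≡y′ = trans (E-% x y) (trans (cong₂ E x≡x′ y≡y′) (sym (E-% x′ y′)))

  toE : Fin p × Fin q → Fin (p * q)
  toE (x , y) = E (toℕ x) (toℕ y)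

  toE-injective : Injective _≡_ _≡_ toE
  toE-injective {x , y} {x′ , y′} eq =
    cong₂ _,_ (toℕ-%-injective (proj₁ (E-≡⇒%≡ eq))) (toℕ-%-injective (proj₂ (E-≡⇒%≡ eq)))

  coordinates : Fin (p * q) ↔ (Fin p × Fin q)
  coordinates = mk↔ₛ′ coords toE (λ u → toE-injective (toE-coords (toE u))) toE-coords
    where
    onto : ∀ z → ∃ λ i → toE (Inverse.to *↔× i) ≡ z
    onto = injective⇒surjective (λ eq → Injection.injective (↔⇒↣ *↔×) (toE-injective eq))
    coords : Fin (p * q) → Fin p × Fin q
    coords z = Inverse.to *↔× (proj₁ (onto z))
    toE-coords : ∀ z → toE (coords z) ≡ z
    toE-coords z = proj₂ (onto z)

  cx : Fin (p * q) → Fin p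
  cx = proj₁ ∘ Inverse.to coordinates

  cy : Fin (p * q) → Fin q
  cy = proj₂ ∘ Inverse.to coordinates

  E-coords : ∀ z → E (toℕ (cx z)) (toℕ (cy z)) ≡ z
  E-coords = Inverse.strictlyInverseʳ coordinates

  coords-E : ∀ x y → toℕ (cx (E x y)) ≡ x % p × toℕ (cy (E x y)) ≡ y % q
  coords-E x y = trans (sym (m<n⇒m%n≡m (toℕ<n (cx (E x y))))) (proj₁ residues) ,
                 trans (sym (m<n⇒m%n≡m (toℕ<n (cy (E x y))))) (proj₂ residues)
    where
    residues = E-≡⇒%≡ (E-coords (E x y))

  coords-∙ : ∀ z w → toℕ (cx (z ∙ w)) ≡ (toℕ (cx z) + toℕ (cx w)) % p
                   × toℕ (cy (z ∙ w)) ≡ (toℕ (cy z) + toℕ (cy w)) % q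
  coords-∙ z w = subst (λ u → toℕ (cx u) ≡ a % p × toℕ (cy u) ≡ b % q) (sym z∙w≡E) (coords-E a b)
    where
    a = toℕ (cx z) + toℕ (cx w)
    b = toℕ (cy z) + toℕ (cy w)
    z∙w≡E : z ∙ w ≡ E a b
    z∙w≡E = trans (cong₂ _∙_ (sym (E-coords z)) (sym (E-coords w))) (sym (E-+ _ _ _ _))

  -- H (b , c) is the subgroup of order p^[b] q^[c]: its p-coordinates are free iff b,
  -- its q-coordinates iff c.
  H : Bool × Bool → Subset (p * q)
  H (b , c) = subsetOf (λ z → Within? b (cx z) ×-dec Within? c (cy z))

  ∈H⇔ : ∀ b c {z} → z ∈ H (b , c) ⇔ (Within b (cx z) × Within c (cy z))
  ∈H⇔ b c = ∈-subsetOf (λ z → Within? b (cx z) ×-dec Within? c (cy z))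

  H-subgroup : ∀ bc → IsSubgroup G (H bc)
  H-subgroup (b , c) = ∙-closed⇒subgroup (p * q) (λ {z} _ → N×ᴳz≡ε z) ε∈H ∙-closed
    where
    ε-coords : toℕ (cx ε) ≡ 0 × toℕ (cy ε) ≡ 0
    ε-coords = subst (λ u → toℕ (cx u) ≡ 0 × toℕ (cy u) ≡ 0) E00≡ε
      (zip trans trans (coords-E 0 0) (0%n≡0 p , 0%n≡0 q))
    ε∈H : ε ∈ H (b , c)
    ε∈H = Equivalence.from (∈H⇔ b c) (Within-zero b (proj₁ ε-coords) , Within-zero c (proj₂ ε-coords))
    ∙-closed : ∀ x y → x ∈ H (b , c) → y ∈ H (b , c) → (x ∙ y) ∈ H (b , c)
    ∙-closed x y x∈H y∈H = Equivalence.from (∈H⇔ b c)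
      ( Within-+ b (proj₁ (coords-∙ x y)) (proj₁ wx) (proj₁ wy)
      , Within-+ c (proj₂ (coords-∙ x y)) (proj₂ wx) (proj₂ wy))
      where
      wx = Equivalence.to (∈H⇔ b c) x∈H
      wy = Equivalence.to (∈H⇔ b c) y∈H

  classOf : Subset (p * q) → Bool × Bool
  classOf K = does (E 1 0 ∈? K) , does (E 0 1 ∈? K)

  module _ {K : Subset (p * q)} (K-subgroup : IsSubgroup G K) where
    private
      ε∈K = proj₁ K-subgroup
      ∙-closed = proj₁ (proj₂ K-subgroup)

    multiple-∈ : ∀ {x y} → E x y ∈ K → ∀ k → E (k * x) (k * y) ∈ K
    multiple-∈ {x} {y} E∈K k = subst (_∈ K) (×ᴳ-E k x y) (×ᴳ-∈ ε∈K ∙-closed k E∈K)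

    power-∈ : ∀ {z} → z ∈ K → ∀ k → E (k * toℕ (cx z)) (k * toℕ (cy z)) ∈ K
    power-∈ {z} z∈K = multiple-∈ (subst (_∈ K) (sym (E-coords z)) z∈K)

    -- (q v) ×ᴳ z = E 1 0 for v an inverse of q · cx z modulo p.
    cx≢0⇒E10∈ : ∀ {z} → z ∈ K → toℕ (cx z) ≢ 0 → E 1 0 ∈ K
    cx≢0⇒E10∈ {z} z∈K a≢0 = subst (_∈ K) (E-%-cong x-residue y-residue) (power-∈ z∈K (q * v))
      where
      a = toℕ (cx z)
      b = toℕ (cy z)
      inverse : ∃ λ v → (q * a * v) % p ≡ 1
      inverse = %-inverse-prime pP (prime∤*-< pP p∤q a≢0 (toℕ<n (cx z)))
      v = proj₁ inverse
      x-residue : (q * v * a) % p ≡ 1 % p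
      x-residue = trans (cong (_% p) (solve 3 (λ q v a → q :* v :* a := q :* a :* v) refl q v a))
                    (trans (proj₂ inverse) (sym (m<n⇒m%n≡m (prime>1 pP))))
      y-residue : (q * v * b) % q ≡ 0 % q
      y-residue = trans (n∣m⇒m%n≡0 _ q (∣m⇒∣m*n b (m∣m*n v))) (sym (0%n≡0 q))

    cy≢0⇒E01∈ : ∀ {z} → z ∈ K → toℕ (cy z) ≢ 0 → E 0 1 ∈ K
    cy≢0⇒E01∈ {z} z∈K b≢0 = subst (_∈ K) (E-%-cong x-residue y-residue) (power-∈ z∈K (p * v))
      where
      a = toℕ (cx z)
      b = toℕ (cy z)
      inverse : ∃ λ v → (p * b * v) % q ≡ 1
      inverse = %-inverse-prime qP (prime∤*-< qP q∤p b≢0 (toℕ<n (cy z)))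
      v = proj₁ inverse
      x-residue : (p * v * a) % p ≡ 0 % p
      x-residue = trans (n∣m⇒m%n≡0 _ p (∣m⇒∣m*n a (m∣m*n v))) (sym (0%n≡0 p))
      y-residue : (p * v * b) % q ≡ 1 % q
      y-residue = trans (cong (_% q) (solve 3 (λ p v b → p :* v :* b := p :* b :* v) refl p v b))
                    (trans (proj₂ inverse) (sym (m<n⇒m%n≡m (prime>1 qP))))

    E00∈K : E 0 0 ∈ K
    E00∈K = subst (_∈ K) (sym E00≡ε) ε∈K

    Ex0∈ : ∀ {x : Fin p} → Within (proj₁ (classOf K)) x → E (toℕ x) 0 ∈ K
    Ex0∈ {x} w with E 1 0 ∈? K
    ... | yes E10∈K = subst (_∈ K) (cong₂ E (*-identityʳ (toℕ x)) (*-zeroʳ (toℕ x))) (multiple-∈ E10∈K (toℕ x))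
    ... | no _      = subst (λ k → E k 0 ∈ K) (sym w) E00∈K

    E0y∈ : ∀ {y : Fin q} → Within (proj₂ (classOf K)) y → E 0 (toℕ y) ∈ K
    E0y∈ {y} w with E 0 1 ∈? K
    ... | yes E01∈K = subst (_∈ K) (cong₂ E (*-zeroʳ (toℕ y)) (*-identityʳ (toℕ y))) (multiple-∈ E01∈K (toℕ y))
    ... | no _      = subst (λ k → E 0 k ∈ K) (sym w) E00∈K

    within-classOf : ∀ {z} → z ∈ K → Within (proj₁ (classOf K)) (cx z) × Within (proj₂ (classOf K)) (cy z)
    within-classOf {z} z∈K = p-part , q-part
      where
      p-part : Within (proj₁ (classOf K)) (cx z)
      p-part with E 1 0 ∈? K
      ... | yes _     = tt
      ... | no E10∉K = decidable-stable (toℕ (cx z) ≟ 0) (E10∉K ∘ cx≢0⇒E10∈ z∈K)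
      q-part : Within (proj₂ (classOf K)) (cy z)
      q-part with E 0 1 ∈? K
      ... | yes _     = tt
      ... | no E01∉K = decidable-stable (toℕ (cy z) ≟ 0) (E01∉K ∘ cy≢0⇒E01∈ z∈K)

  ∈⇔∈H-classOf : ∀ {K} → IsSubgroup G K → ∀ {z} → z ∈ K ⇔ z ∈ H (classOf K)
  ∈⇔∈H-classOf {K} K-subgroup {z} = mk⇔ (Equivalence.from (∈H⇔ _ _) ∘ within-classOf K-subgroup) recombine
    where
    recombine : z ∈ H (classOf K) → z ∈ K
    recombine z∈H =
      subst (_∈ K) split (proj₁ (proj₂ K-subgroup) _ _ (Ex0∈ K-subgroup (proj₁ w)) (E0y∈ K-subgroup (proj₂ w)))
      where
      a = toℕ (cx z)
      b = toℕ (cy z)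
      split : E a 0 ∙ E 0 b ≡ z
      split = trans (sym (E-+ a 0 0 b)) (trans (cong (λ x → E x b) (+-identityʳ a)) (E-coords z))
      w = Equivalence.to (∈H⇔ (proj₁ (classOf K)) (proj₂ (classOf K))) z∈H

  ≡H-classOf : ∀ {K} → IsSubgroup G K → K ≡ H (classOf K)
  ≡H-classOf K-subgroup =
    ⊆-antisym (Equivalence.to (∈⇔∈H-classOf K-subgroup)) (Equivalence.from (∈⇔∈H-classOf K-subgroup))

  classOf-H : ∀ bc → classOf (H bc) ≡ bc
  classOf-H (b , c) = cong₂ _,_ (E10∈H b) (E01∈H c)
    where
    E10-coords : toℕ (cx (E 1 0)) ≡ 1 × toℕ (cy (E 1 0)) ≡ 0
    E10-coords = zip trans trans (coords-E 1 0) (m<n⇒m%n≡m (prime>1 pP) , 0%n≡0 q)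
    E01-coords : toℕ (cx (E 0 1)) ≡ 0 × toℕ (cy (E 0 1)) ≡ 1
    E01-coords = zip trans trans (coords-E 0 1) (0%n≡0 p , m<n⇒m%n≡m (prime>1 qP))
    E10∈H : ∀ b → does (E 1 0 ∈? H (b , c)) ≡ b
    E10∈H true  = dec-true (E 1 0 ∈? _) (Equivalence.from (∈H⇔ true c) (tt , Within-zero c (proj₂ E10-coords)))
    E10∈H false = dec-false (E 1 0 ∈? _)
      (λ e → 1+n≢0 (trans (sym (proj₁ E10-coords)) (proj₁ (Equivalence.to (∈H⇔ false c) e))))
    E01∈H : ∀ c → does (E 0 1 ∈? H (b , c)) ≡ c
    E01∈H true  = dec-true (E 0 1 ∈? _) (Equivalence.from (∈H⇔ b true) (Within-zero b (proj₁ E01-coords) , tt))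
    E01∈H false = dec-false (E 0 1 ∈? _)
      (λ e → 1+n≢0 (trans (sym (proj₂ E01-coords)) (proj₂ (Equivalence.to (∈H⇔ b false) e))))

  spanClass : Fin (p * q) → Fin (p * q) → Bool × Bool
  spanClass a b = anyNonzero (cx a , cx b) , anyNonzero (cy a , cy b)

  generates : ∀ a b → Generates₂ G a b (H (spanClass a b))
  generates a b = H-subgroup (spanClass a b) , contains , least
    where
    ∈H⇔′ = ∈H⇔ (anyNonzero (cx a , cx b)) (anyNonzero (cy a , cy b))
    wx = within-anyNonzero (cx a) (cx b)
    wy = within-anyNonzero (cy a) (cy b)
    contains : ∀ x → (x ≡ a) ⊎ (x ≡ b) → x ∈ H (spanClass a b)
    contains _ (inj₁ refl) = Equivalence.from ∈H⇔′ (proj₁ wx , proj₁ wy)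
    contains _ (inj₂ refl) = Equivalence.from ∈H⇔′ (proj₂ wx , proj₂ wy)
    least : ∀ K → IsSubgroup G K → (∀ x → (x ≡ a) ⊎ (x ≡ b) → x ∈ K) → H (spanClass a b) ⊆ K
    least K K-subgroup a,b∈K z∈H = Equivalence.from (∈⇔∈H-classOf K-subgroup) (Equivalence.from (∈H⇔ _ _)
      ( Within-mono (anyNonzero-least (proj₁ ka) (proj₁ kb)) (proj₁ w)
      , Within-mono (anyNonzero-least (proj₂ ka) (proj₂ kb)) (proj₂ w)))
      where
      ka = within-classOf K-subgroup (a,b∈K a (inj₁ refl))
      kb = within-classOf K-subgroup (a,b∈K b (inj₂ refl))
      w  = Equivalence.to ∈H⇔′ z∈H

  subgroupOf : Bool × Bool → SubgroupOf G
  subgroupOf bc = H bc , fromWitness (H-subgroup bc)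

  classification : SubgroupOf G ↔ (Bool × Bool)
  classification = mk↔ₛ′ (classOf ∘ proj₁) subgroupOf classOf-H
    (λ K → SubgroupOf-≡ G (sym (≡H-classOf (toWitness (proj₂ K)))))

  span : Fin (p * q) × Fin (p * q) → SubgroupOf G
  span (a , b) = subgroupOf (spanClass a b)

  pairCoordinates : (Fin (p * q) × Fin (p * q)) ↔ ((Unit ⊎ Fin (p * p ∸ 1)) × (Unit ⊎ Fin (q * q ∸ 1)))
  pairCoordinates =
    ↔-trans (×-cong coordinates coordinates) (↔-trans ×-interchange (×-cong (pairSplit p) (pairSplit q)))

  support-pairCoordinates : ∀ ab → support (Inverse.to pairCoordinates ab) ≡ Inverse.to classification (span ab)
  support-pairCoordinates (a , b) = sym (classOf-H (spanClass a b))

mainTheorem1 : (p q : ℕ) → Prime p → Prime q → p < q →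
    (G : FinGroup (p * q)) → IsCyclic G →
    SGB G ≅ (K₂ ⊔ K₁ (p ^ 2 ∸ 1) ⊔ K₁ (q ^ 2 ∸ 1) ⊔ K₁ (p ^ 2 * q ^ 2 ∸ p ^ 2 ∸ q ^ 2 + 1))
mainTheorem1 p q pP qP p<q G (g , gen) =
  ≅-trans (SGB≅functionGraph G span generates)
  (≅-trans (functionGraph-cong pairCoordinates classification support-pairCoordinates)
  (≅-trans (functionGraph-support≅stars (p * p ∸ 1) (q * q ∸ 1))
           (⊔-cong K₁1≅K₂ (⊔-cong (K₁-cong (square∸1 p)) (⊔-cong (K₁-cong (square∸1 q)) (K₁-cong count))))))
  where
  open CyclicOfOrderPQ pP qP (<⇒≢ p<q) G gen
  square∸1 : ∀ m → m * m ∸ 1 ≡ m ^ 2 ∸ 1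
  square∸1 m = cong (λ k → m * k ∸ 1) (sym (*-identityʳ m))
  count : (p * p ∸ 1) * (q * q ∸ 1) ≡ p ^ 2 * q ^ 2 ∸ p ^ 2 ∸ q ^ 2 + 1
  count = trans (cong₂ _*_ (square∸1 p) (square∸1 q))
                ([m∸1]*[n∸1]≡m*n∸m∸n+1 (prime²≥2 pP) (prime²≥2 qP))
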